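{- Let $p$ be a prime with $p\equiv1\pmod 4$ and $p\neq5$. Then for any integer $L$ satisfying $\frac{p-1}{2}\le L\le p-1$, the interval $\mathcal{I}=\{1,2,\ldots,L\}\pmod p$ admits a nontrivial multiplicative decomposition.
   Context: $\mathbb{F}_p$ is the field of residues modulo the prime $p$. For $\mathcal{A},\mathcal{B}\subset\mathbb{F}_p$, $\mathcal{A}\mathcal{B}=\{ab:\ a\in\mathcal{A},\ b\in\mathcal{B}\}$. A set $\mathcal{S}\subset\mathbb{F}_p$ is said to admit (have) a nontrivial multiplicative decomposition if $\mathcal{S}\setminus\{0\}=\mathcal{A}\mathcal{B}$ for some sets $\mathcal{A},\mathcal{B}\subset\mathbb{F}_p$ with $|\mathcal{A}|\ge2$ and $|\mathcal{B}|\ge2$. -}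

module Defs where

open import Data.Nat using (ℕ; zero; suc; _*_; _≤_; NonZero)
open import Data.Nat.DivMod using (_%_; m%n<n)
open import Data.Fin using (Fin; toℕ; fromℕ<)
open import Data.Fin.Subset using (Subset; _∈_)
open import Data.Product using (Σ; ∃; _×_; _,_)
open import Relation.Binary.PropositionalEquality using (_≡_; _≢_)
open import Function.Bundles using (_⇔_)

-- Residues modulo p are represented by Fin p (canonical representatives 0..p-1).
-- Multiplication in ℤ/pℤ.
mulMod : ∀ {p} .{{_ : NonZero p}} → Fin p → Fin p → Fin p
mulMod {p} a b = fromℕ< (m%n<n (toℕ a * toℕ b) p)

_∈Prod[_,_] : ∀ {p} .{{_ : NonZero p}} → Fin p → Subset p → Subset p → Set
_∈Prod[_,_] {p} x A B = Σ (Fin p) λ a → Σ (Fin p) λ b → a ∈ A × b ∈ B × mulMod a b ≡ x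

AtLeastTwo : ∀ {p} → Subset p → Set
AtLeastTwo {p} A = Σ (Fin p) λ a → Σ (Fin p) λ b → a ∈ A × b ∈ A × a ≢ b

HasNontrivialMultDecomp : (p : ℕ) .{{_ : NonZero p}} → (Fin p → Set) → Set
HasNontrivialMultDecomp p S =
  Σ (Subset p) λ A → Σ (Subset p) λ B →
    AtLeastTwo A × AtLeastTwo B ×
    (∀ (x : Fin p) → ((S x × toℕ x ≢ 0) ⇔ (x ∈Prod[ A , B ])))

Interval : (p L : ℕ) → Fin p → Set
Interval p L x = (1 ≤ toℕ x) × (toℕ x ≤ L)

{-# OPTIONS --safe #-}
-- Write p = 2h + 1 with h even. Sending x ∈ [2, h] to the unique y ∈ [1, h] with x y ≡ ±1 (mod p)
-- is an involution of [2, h] (y = 1 would give x ≡ ±1), and [2, h] has odd size h − 1, so it has a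
-- fixed point x. As x² ≡ 1 only for x ≡ ±1, that fixed point is some i ∈ [2, h] with i² ≡ −1.
-- Now take A = {1, i} and B = {b ∈ I : i b ∈ I} for I = [1, L]. Clearly A B ⊆ I. Conversely, if
-- x ∈ I but i x ∉ I, then the representative r of i x exceeds L ≥ h, so b = p − r lies in [1, h] ⊆ I
-- and i b ≡ −i² x ≡ x ∈ I; thus x = i b with b ∈ B. Besides 1, B contains the cofactor of 2 in such
-- a factorisation, which is 1 only if i = 2, i.e. p ∣ 5.
module Submission where

open import Defs
open import Data.Nat using (ℕ; _≤_; _∸_; _/_; _%_)
open import Data.Nat.Primality using (Prime; prime⇒nonZero)
open import Relation.Binary.PropositionalEquality using (_≡_; _≢_)

open import Level using (Level)
open import Data.Bool using (true; if_then_else_)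
open import Data.Empty using (⊥-elim)
open import Data.Fin using (Fin; toℕ; fromℕ<)
open import Data.Fin.Properties using (toℕ-fromℕ<; fromℕ<-cong; fromℕ<-toℕ; toℕ<n)
open import Data.Fin.Subset using (Subset; _∈_; ⁅_⁆; _∪_)
open import Data.Fin.Subset.Properties
  using (x∈⁅x⁆; x∈⁅y⁆⇒x≡y; x∈p∪q⁻; p⊆p∪q; q⊆p∪q)
open import Data.Nat.Base using (suc; zero; pred; _+_; _*_; _<_; z≤n; s≤s; s≤s⁻¹; NonZero)
open import Data.Nat.Properties
open import Data.Nat.DivMod
  using ( m%n%n≡m%n; %-distribˡ-+; %-distribˡ-*; %-remove-+ʳ; m%n<n; m%n≤n; m<n⇒m%n≡m
        ; [m+kn]%n≡m%n; m≡m%n+[m/n]*n; m*n/n≡m)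
open import Data.Nat.Divisibility
  using ( _∣_; divides; _∣0; ∣-refl; ∣1⇒≡1; ∣m⇒∣m*n; ∣n⇒∣m*n; n∣m*n; >⇒∤; _∣?_
        ; m%n≡0⇒n∣m; n∣m⇒m%n≡0)
open import Data.Nat.Coprimality using (Coprime; coprime-Bézout)
open import Data.Nat.GCD using (module Bézout)
open import Data.Nat.Primality using (¬prime[1]; prime⇒irreducible; euclidsLemma; prime?)
open import Data.Nat.Tactic.RingSolver using (solve-∀)
open import Data.Product using (Σ; ∃; _×_; _,_; proj₁; proj₂)
open import Data.Sum as Sum using (_⊎_; inj₁; inj₂)
open import Data.Vec using (tabulate)
open import Data.Vec.Properties using (lookup∘tabulate; lookup⇒[]=; []=⇒lookup)
open import Function using (_∘_)
open import Function.Bundles using (mk⇔)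
open import Relation.Binary.PropositionalEquality
  using (refl; sym; ≢-sym; trans; cong; cong₂; subst; module ≡-Reasoning)
open import Relation.Nullary using (¬_; Dec; yes; no; does; proof; contradiction)
open import Relation.Nullary.Reflects using (Reflects; invert)
open import Relation.Nullary.Decidable using (dec-true; dec-false; from-yes; ¬?; _×-dec_)
open import Relation.Unary using (Pred; Decidable; _∩_)

private
  variable
    ℓ : Level
    a b c d x y : ℕ

count : {P : Pred ℕ ℓ} → Decidable P → ℕ → ℕ
count P? zero    = 0
count P? (suc n) = if does (P? n) then suc (count P? n) else count P? n

module _ {P : Pred ℕ ℓ} (P? : Decidable P) {n : ℕ} where

  count-yes : P n → count P? (suc n) ≡ suc (count P? n)
  count-yes Pn rewrite dec-true (P? n) Pn = refl

  count-no : ¬ P n → count P? (suc n) ≡ count P? n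
  count-no ¬Pn rewrite dec-false (P? n) ¬Pn = refl

count-cong : ∀ {ℓ′} {P : Pred ℕ ℓ} {Q : Pred ℕ ℓ′} (P? : Decidable P) (Q? : Decidable Q) n →
  (∀ {x} → x < n → P x → Q x) → (∀ {x} → x < n → Q x → P x) →
  count P? n ≡ count Q? n
count-cong P? Q? zero _ _ = refl
count-cong P? Q? (suc n) P⇒Q Q⇒P with P? n | Q? n
... | yes _  | yes _  = cong suc (count-cong P? Q? n (P⇒Q ∘ m<n⇒m<1+n) (Q⇒P ∘ m<n⇒m<1+n))
... | no _   | no _   = count-cong P? Q? n (P⇒Q ∘ m<n⇒m<1+n) (Q⇒P ∘ m<n⇒m<1+n)
... | yes Pn | no ¬Qn = contradiction (P⇒Q ≤-refl Pn) ¬Qn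
... | no ¬Pn | yes Qn = contradiction (Q⇒P ≤-refl Qn) ¬Pn

count-positive : {P : Pred ℕ ℓ} (P? : Decidable P) → ∀ n →
  count P? n ≡ suc c → ∃ λ x → x < n × P x
count-positive P? (suc n) eq with P? n
... | yes Pn = n , n<1+n n , Pn
... | no _ with count-positive P? n eq
...   | x , x<n , Px = x , m<n⇒m<1+n x<n , Px

infixl 6 _∖?_

_∖?_ : {P : Pred ℕ ℓ} → Decidable P → (y : ℕ) → Decidable (P ∩ (_≢ y))
(P? ∖? y) x = P? x ×-dec ¬? (x ≟ y)

count-remove : {P : Pred ℕ ℓ} (P? : Decidable P) → ∀ {n y} → y < n → P y →
  count P? n ≡ suc (count (P? ∖? y) n)
count-remove {P = P} P? {suc n} {y} y<1+n Py with m≤n⇒m<n∨m≡n (s≤s⁻¹ y<1+n)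
... | inj₂ refl = begin
  count P? (suc y)              ≡⟨ count-yes P? Py ⟩
  suc (count P? y)              ≡⟨ cong suc (count-cong P? (P? ∖? y) y below-y drop-≢) ⟩
  suc (count (P? ∖? y) y)       ≡⟨ cong suc (count-no (P? ∖? y) (λ (_ , y≢y) → y≢y refl)) ⟨
  suc (count (P? ∖? y) (suc y)) ∎
  where
  open ≡-Reasoning
  below-y : ∀ {x} → x < y → P x → P x × x ≢ y
  below-y x<y Px = Px , <⇒≢ x<y
  drop-≢ : ∀ {x} → x < y → P x × x ≢ y → P x
  drop-≢ _ = proj₁
... | inj₁ y<n = step (P? n)
  where
  open ≡-Reasoning
  step : Dec (P n) → count P? (suc n) ≡ suc (count (P? ∖? y) (suc n))
  step (yes Pn) = begin
    count P? (suc n)              ≡⟨ count-yes P? Pn ⟩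
    suc (count P? n)              ≡⟨ cong suc (count-remove P? y<n Py) ⟩
    suc (suc (count (P? ∖? y) n)) ≡⟨ cong suc (count-yes (P? ∖? y) (Pn , >⇒≢ y<n)) ⟨
    suc (count (P? ∖? y) (suc n)) ∎
  step (no ¬Pn) = begin
    count P? (suc n)              ≡⟨ count-no P? ¬Pn ⟩
    count P? n                    ≡⟨ count-remove P? y<n Py ⟩
    suc (count (P? ∖? y) n)       ≡⟨ cong suc (count-no (P? ∖? y) (¬Pn ∘ proj₁)) ⟨
    suc (count (P? ∖? y) (suc n)) ∎

FreeInvolution : ℕ → Pred ℕ ℓ → (ℕ → ℕ) → Set ℓ
FreeInvolution n P f =
  ∀ {x} → x < n → P x → f x < n × P (f x) × f (f x) ≡ x × f x ≢ x

remove-pair : {P : Pred ℕ ℓ} (P? : Decidable P) → ∀ {n f} →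
  FreeInvolution n P f → count P? n ≡ suc c →
  Σ (Pred ℕ ℓ) λ Q → Σ (Decidable Q) λ Q? →
    FreeInvolution n Q f × count P? n ≡ 2 + count Q? n
remove-pair {P = P} P? {n} {f} inv eq with count-positive P? n eq
... | x , x<n , Px with inv x<n Px
... | fx<n , Pfx , ffx≡x , fx≢x =
  (P ∩ (_≢ x)) ∩ (_≢ f x) , P? ∖? x ∖? f x , inv′ ,
  trans (count-remove P? x<n Px) (cong suc (count-remove (P? ∖? x) fx<n (Pfx , fx≢x)))
  where
  inv′ : FreeInvolution n ((P ∩ (_≢ x)) ∩ (_≢ f x)) f
  inv′ {y} y<n ((Py , y≢x) , y≢fx) with inv y<n Py
  ... | fy<n , Pfy , ffy≡y , fy≢y = fy<n , ((Pfy , fy≢x) , fy≢fx) , ffy≡y , fy≢y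
    where
    fy≢x : f y ≢ x
    fy≢x fy≡x = y≢fx (trans (sym ffy≡y) (cong f fy≡x))
    fy≢fx : f y ≢ f x
    fy≢fx fy≡fx = y≢x (trans (sym ffy≡y) (trans (cong f fy≡fx) ffx≡x))

private
  count-even′ : ∀ c {P : Pred ℕ ℓ} (P? : Decidable P) {n f} → FreeInvolution n P f →
    count P? n ≡ c → ∃ λ k → c ≡ 2 * k
  count-even′ zero P? inv eq = 0 , refl
  count-even′ (suc zero) P? inv eq with remove-pair P? inv eq
  ... | _ , _ , _ , eq′ = contradiction (trans (sym eq) eq′) λ ()
  count-even′ (suc (suc c)) P? inv eq with remove-pair P? inv eq
  ... | _ , Q? , invQ , eq′
    with count-even′ c Q? invQ (suc-injective (suc-injective (trans (sym eq′) eq)))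
  ...   | k , c≡2k = suc k , trans (cong (2 +_) c≡2k) (sym (*-suc 2 k))

count-even : {P : Pred ℕ ℓ} (P? : Decidable P) → ∀ {n f} →
  FreeInvolution n P f → ∃ λ k → count P? n ≡ 2 * k
count-even P? inv = count-even′ _ P? inv refl

count-atLeast : ∀ m n → count (m ≤?_) n ≡ n ∸ m
count-atLeast m zero = sym (0∸n≡0 m)
count-atLeast m (suc n) with m ≤? n
... | yes m≤n = begin
  count (m ≤?_) (suc n) ≡⟨ count-yes (m ≤?_) m≤n ⟩
  suc (count (m ≤?_) n) ≡⟨ cong suc (count-atLeast m n) ⟩
  suc (n ∸ m)           ≡⟨ +-∸-assoc 1 m≤n ⟨
  suc n ∸ m             ∎
  where open ≡-Reasoning
... | no m≰n = begin
  count (m ≤?_) (suc n) ≡⟨ count-no (m ≤?_) m≰n ⟩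
  count (m ≤?_) n       ≡⟨ count-atLeast m n ⟩
  n ∸ m                 ≡⟨ m≤n⇒m∸n≡0 (<⇒≤ n<m) ⟩
  0                     ≡⟨ m≤n⇒m∸n≡0 n<m ⟨
  suc n ∸ m             ∎
  where
  open ≡-Reasoning
  n<m : n < m
  n<m = ≰⇒> m≰n

subsetOf : ∀ {n} {P : Pred (Fin n) ℓ} → Decidable P → Subset n
subsetOf P? = tabulate (does ∘ P?)

module _ {n} {P : Pred (Fin n) ℓ} (P? : Decidable P) {x : Fin n} where

  ∈-subsetOf⁺ : P x → x ∈ subsetOf P?
  ∈-subsetOf⁺ Px = lookup⇒[]= x _ (trans (lookup∘tabulate _ x) (dec-true (P? x) Px))

  ∈-subsetOf⁻ : x ∈ subsetOf P? → P x
  ∈-subsetOf⁻ x∈ = invert (subst (Reflects (P x)) does≡true (proof (P? x)))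
    where
    does≡true : does (P? x) ≡ true
    does≡true = trans (sym (lookup∘tabulate _ x)) ([]=⇒lookup x∈)

module Congruence (p : ℕ) .{{_ : NonZero p}} where

  infix 4 _≈_ _≈±_

  _≈_ : ℕ → ℕ → Set
  a ≈ b = a % p ≡ b % p

  data _≈±_ (a b : ℕ) : Set where
    same     : a ≈ b → a ≈± b
    opposite : p ∣ a + b → a ≈± b

  %-≈ : ∀ a → a % p ≈ a
  %-≈ a = m%n%n≡m%n a p

  +-cong : a ≈ b → c ≈ d → a + c ≈ b + d
  +-cong {a} {b} {c} {d} a≈b c≈d = begin
    (a + c) % p         ≡⟨ %-distribˡ-+ a c p ⟩
    (a % p + c % p) % p ≡⟨ cong₂ (λ u v → (u + v) % p) a≈b c≈d ⟩
    (b % p + d % p) % p ≡⟨ %-distribˡ-+ b d p ⟨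
    (b + d) % p         ∎
    where open ≡-Reasoning

  *-cong : a ≈ b → c ≈ d → a * c ≈ b * d
  *-cong {a} {b} {c} {d} a≈b c≈d = begin
    (a * c) % p         ≡⟨ %-distribˡ-* a c p ⟩
    (a % p * (c % p)) % p ≡⟨ cong₂ (λ u v → (u * v) % p) a≈b c≈d ⟩
    (b % p * (d % p)) % p ≡⟨ %-distribˡ-* b d p ⟨
    (b * d) % p         ∎
    where open ≡-Reasoning

  +-congˡ : ∀ x → a ≈ b → x + a ≈ x + b
  +-congˡ x = +-cong {x} {x} refl

  +-congʳ : ∀ x → a ≈ b → a + x ≈ b + x
  +-congʳ x a≈b = +-cong a≈b (refl {x = x % p})

  *-congˡ : ∀ x → a ≈ b → x * a ≈ x * b
  *-congˡ x = *-cong {x} {x} refl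

  *-congʳ : ∀ x → a ≈ b → a * x ≈ b * x
  *-congʳ x a≈b = *-cong a≈b (refl {x = x % p})

  ∣-resp-≈ : a ≈ b → p ∣ a → p ∣ b
  ∣-resp-≈ {a} {b} a≈b p∣a = m%n≡0⇒n∣m b p (trans (sym a≈b) (n∣m⇒m%n≡0 a p p∣a))

  ∣∧∣⇒≈ : p ∣ a → p ∣ b → a ≈ b
  ∣∧∣⇒≈ {a} {b} p∣a p∣b = trans (n∣m⇒m%n≡0 a p p∣a) (sym (n∣m⇒m%n≡0 b p p∣b))

  +-inverse : ∀ c → p ∣ c + pred p * c
  +-inverse c = subst (λ q → p ∣ q * c) (sym (suc-pred p)) (∣m⇒∣m*n c ∣-refl)

  +-cancelʳ : a + c ≈ b + c → a ≈ b
  +-cancelʳ {a} {c} {b} a+c≈b+c = begin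
    a % p              ≡⟨ %-remove-+ʳ a (+-inverse c) ⟨
    (a + (c + c⁻)) % p ≡⟨ cong (_% p) (+-assoc a c c⁻) ⟨
    (a + c + c⁻) % p   ≡⟨ +-cong a+c≈b+c refl ⟩
    (b + c + c⁻) % p   ≡⟨ cong (_% p) (+-assoc b c c⁻) ⟩
    (b + (c + c⁻)) % p ≡⟨ %-remove-+ʳ b (+-inverse c) ⟩
    b % p              ∎
    where
    open ≡-Reasoning
    c⁻ : ℕ
    c⁻ = pred p * c

  negation-unique : p ∣ a + c → p ∣ b + c → a ≈ b
  negation-unique p∣a+c p∣b+c = +-cancelʳ (∣∧∣⇒≈ p∣a+c p∣b+c)

  ≈-via-inverse : a ≈ b → p ∣ a + pred p * b
  ≈-via-inverse {a} {b} a≈b = ∣-resp-≈ (+-cong (sym a≈b) refl) (+-inverse b)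

  ≈±-sym : a ≈± b → b ≈± a
  ≈±-sym (same a≈b) = same (sym a≈b)
  ≈±-sym {a} {b} (opposite p∣a+b) = opposite (subst (p ∣_) (+-comm a b) p∣a+b)

  ≈±-trans : a ≈± b → b ≈± c → a ≈± c
  ≈±-trans (same a≈b)       (same b≈c)     = same (trans a≈b b≈c)
  ≈±-trans (same a≈b)       (opposite p∣b+c) = opposite (∣-resp-≈ (+-cong (sym a≈b) refl) p∣b+c)
  ≈±-trans (opposite p∣a+b) (same b≈c)       = opposite (∣-resp-≈ (+-cong refl b≈c) p∣a+b)
  ≈±-trans {a} {b} {c} (opposite p∣a+b) (opposite p∣b+c) =
    same (negation-unique p∣a+b (subst (p ∣_) (+-comm b c) p∣b+c))

  *-congˡ-≈± : ∀ x → a ≈± b → x * a ≈± x * b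
  *-congˡ-≈± x (same a≈b) = same (*-congˡ x a≈b)
  *-congˡ-≈± {a} {b} x (opposite p∣a+b) =
    opposite (subst (p ∣_) (*-distribˡ-+ x a b) (∣n⇒∣m*n x p∣a+b))

  residue : ℕ → Fin p
  residue a = fromℕ< (m%n<n a p)

  toℕ-residue : ∀ a → toℕ (residue a) ≈ a
  toℕ-residue a = trans (cong (_% p) (toℕ-fromℕ< _)) (%-≈ a)

  toℕ-residue-< : a < p → toℕ (residue a) ≡ a
  toℕ-residue-< a<p = trans (toℕ-fromℕ< _) (m<n⇒m%n≡m a<p)

  residue-cong : a ≈ b → residue a ≡ residue b
  residue-cong {a} {b} a≈b = fromℕ<-cong _ _ a≈b (m%n<n a p) (m%n<n b p)

  residue-injective : a < p → b < p → residue a ≡ residue b → a ≡ b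
  residue-injective a<p b<p eq =
    trans (sym (toℕ-residue-< a<p)) (trans (cong toℕ eq) (toℕ-residue-< b<p))

  residue-toℕ : ∀ (x : Fin p) → residue (toℕ x) ≡ x
  residue-toℕ x =
    trans (fromℕ<-cong _ _ (m<n⇒m%n≡m (toℕ<n x)) _ (toℕ<n x)) (fromℕ<-toℕ x (toℕ<n x))

  mulMod-≈ : ∀ {u v w : Fin p} → toℕ u * toℕ v ≈ toℕ w → mulMod u v ≡ w
  mulMod-≈ {w = w} uv≈w = trans (residue-cong uv≈w) (residue-toℕ w)

  mulMod-identityˡ : ∀ (x : Fin p) → mulMod (residue 1) x ≡ x
  mulMod-identityˡ x = mulMod-≈ {residue 1} {x}
    (trans (*-congʳ (toℕ x) (toℕ-residue 1)) (cong (_% p) (*-identityˡ (toℕ x))))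

  mulMod-identityʳ : ∀ (x : Fin p) → mulMod x (residue 1) ≡ x
  mulMod-identityʳ x = mulMod-≈ {x} {residue 1}
    (trans (*-congˡ (toℕ x) (toℕ-residue 1)) (cong (_% p) (*-identityʳ (toℕ x))))

module PrimeModulus {p : ℕ} (pr : Prime p) where

  instance
    p-nonZero : NonZero p
    p-nonZero = prime⇒nonZero pr

  open Congruence p public

  p∤1 : ¬ p ∣ 1
  p∤1 p∣1 = ¬prime[1] (subst Prime (∣1⇒≡1 p∣1) pr)

  ∤-between : 0 < a → a < p → ¬ p ∣ a
  ∤-between {suc a} _ a<p = >⇒∤ a<p

  ∤-* : ¬ p ∣ a → ¬ p ∣ b → ¬ p ∣ a * b
  ∤-* {a} {b} p∤a p∤b p∣ab with euclidsLemma a b pr p∣ab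
  ... | inj₁ p∣a = p∤a p∣a
  ... | inj₂ p∣b = p∤b p∣b

  ∣-prime⇒≡ : ∀ {q} → Prime q → p ∣ q → p ≡ q
  ∣-prime⇒≡ q-prime p∣q with prime⇒irreducible q-prime p∣q
  ... | inj₁ refl = ⊥-elim (¬prime[1] pr)
  ... | inj₂ p≡q = p≡q

  ∤⇒coprime : ¬ p ∣ x → Coprime p x
  ∤⇒coprime p∤x (d∣p , d∣x) with prime⇒irreducible pr d∣p
  ... | inj₁ d≡1 = d≡1
  ... | inj₂ refl = contradiction d∣x p∤x

  *-cancelˡ-≈ : ¬ p ∣ x → x * a ≈ x * b → a ≈ b
  *-cancelˡ-≈ {x} {a} {b} p∤x xa≈xb with euclidsLemma x (a + pred p * b) pr p∣x[a-b]
    where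
    p∣x[a-b] : p ∣ x * (a + pred p * b)
    p∣x[a-b] = subst (p ∣_) (factor x a b (pred p)) (≈-via-inverse xa≈xb)
      where
      factor : ∀ x a b q → x * a + q * (x * b) ≡ x * (a + q * b)
      factor = solve-∀
  ... | inj₁ p∣x = contradiction p∣x p∤x
  ... | inj₂ p∣a-b = negation-unique p∣a-b (+-inverse b)

  *-cancelˡ-≈± : ¬ p ∣ x → x * a ≈± x * b → a ≈± b
  *-cancelˡ-≈± p∤x (same xa≈xb) = same (*-cancelˡ-≈ p∤x xa≈xb)
  *-cancelˡ-≈± {x} {a} {b} p∤x (opposite p∣xa+xb)
    with euclidsLemma x (a + b) pr (subst (p ∣_) (sym (*-distribˡ-+ x a b)) p∣xa+xb)
  ... | inj₁ p∣x = contradiction p∣x p∤x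
  ... | inj₂ p∣a+b = opposite p∣a+b

  ¬0≈±1 : ¬ 0 ≈± 1
  ¬0≈±1 (same 0≈1) = p∤1 (∣-resp-≈ 0≈1 (p ∣0))
  ¬0≈±1 (opposite p∣1) = p∤1 p∣1

  -- x² − 1 = (x − 1)(x + 1), written for x = 1 + y to avoid truncated subtraction.
  square≈1⇒≈±1 : x * x ≈ 1 → x ≈± 1
  square≈1⇒≈±1 {zero} 0≈1 = ⊥-elim (¬0≈±1 (same 0≈1))
  square≈1⇒≈±1 {suc y} x²≈1
    with euclidsLemma y (y + 2) pr (∣-resp-≈ (sym y[y+2]≈0) (p ∣0))
    where
    expand : ∀ y → suc y * suc y ≡ y * (y + 2) + 1
    expand = solve-∀
    y[y+2]≈0 : y * (y + 2) ≈ 0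
    y[y+2]≈0 = +-cancelʳ {c = 1} (trans (cong (_% p) (sym (expand y))) x²≈1)
  ... | inj₁ p∣y = same (+-congˡ 1 (∣∧∣⇒≈ p∣y (p ∣0)))
  ... | inj₂ p∣y+2 = opposite (subst (p ∣_) (+-suc y 1) p∣y+2)

  ±-inverse : ¬ p ∣ x → ∃ λ c → x * c ≈± 1
  ±-inverse {x} p∤x with coprime-Bézout (∤⇒coprime p∤x)
  ... | Bézout.+- u v 1+vx≡up =
    v , opposite (divides u (trans (+-comm (x * v) 1) (trans (cong (1 +_) (*-comm x v)) 1+vx≡up)))
  ... | Bézout.-+ u v 1+up≡vx =
    v , same (trans (cong (_% p) (trans (*-comm x v) (sym 1+up≡vx))) ([m+kn]%n≡m%n 1 u p))

module HalfSystem {p : ℕ} (pr : Prime p) {h : ℕ} (p≡2h+1 : p ≡ suc (h + h)) where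

  open PrimeModulus pr

  ≤2h⇒<p : a ≤ h + h → a < p
  ≤2h⇒<p a≤2h = subst (_ <_) (sym p≡2h+1) (s≤s a≤2h)

  ≤h⇒<p : a ≤ h → a < p
  ≤h⇒<p a≤h = ≤2h⇒<p (≤-trans a≤h (m≤m+n _ _))

  half-injective : 0 < a → a ≤ h → b ≤ h → a ≈± b → a ≡ b
  half-injective _ a≤h b≤h (same a≈b) =
    trans (sym (m<n⇒m%n≡m (≤h⇒<p a≤h))) (trans a≈b (m<n⇒m%n≡m (≤h⇒<p b≤h)))
  half-injective {a} {b} 0<a a≤h b≤h (opposite p∣a+b) =
    contradiction p∣a+b (∤-between (≤-trans 0<a (m≤m+n a b)) (≤2h⇒<p (+-mono-≤ a≤h b≤h)))

  half-representative : ∀ a → ∃ λ z → z ≤ h × a ≈± z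
  half-representative a with a % p ≤? h
  ... | yes r≤h = a % p , r≤h , same (sym (%-≈ a))
  ... | no r≰h = p ∸ a % p , p-r≤h , opposite p∣a+[p-r]
    where
    p-r≤h : p ∸ a % p ≤ h
    p-r≤h = ≤-trans (∸-monoʳ-≤ p (≰⇒> r≰h))
                    (≤-reflexive (trans (cong (_∸ suc h) p≡2h+1) (m+n∸n≡m h h)))
    p∣a+[p-r] : p ∣ a + (p ∸ a % p)
    p∣a+[p-r] = ∣-resp-≈ (+-congʳ _ (%-≈ a)) (subst (p ∣_) (sym (m+[n∸m]≡n (m%n≤n a p))) ∣-refl)

  half-inverse-exists : ¬ p ∣ x → ∃ λ z → 0 < z × z ≤ h × x * z ≈± 1
  half-inverse-exists {x} p∤x with ±-inverse p∤x
  ... | c , xc≈±1 with half-representative c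
  ...   | zero , _ , c≈±0 =
    ⊥-elim (¬0≈±1 (subst (_≈± 1) (*-zeroʳ x) (≈±-trans (≈±-sym (*-congˡ-≈± x c≈±0)) xc≈±1)))
  ...   | suc z , z≤h , c≈±z =
    suc z , s≤s z≤n , z≤h , ≈±-trans (≈±-sym (*-congˡ-≈± x c≈±z)) xc≈±1

  half-inverse-unique : ¬ p ∣ x → 0 < a → a ≤ h → b ≤ h →
    x * a ≈± 1 → x * b ≈± 1 → a ≡ b
  half-inverse-unique p∤x 0<a a≤h b≤h xa≈±1 xb≈±1 =
    half-injective 0<a a≤h b≤h (*-cancelˡ-≈± p∤x (≈±-trans xa≈±1 (≈±-sym xb≈±1)))

  half-inverse : ℕ → ℕ
  half-inverse x with p ∣? x
  ... | yes _ = 0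
  ... | no p∤x = proj₁ (half-inverse-exists p∤x)

  half-inverse-spec : ¬ p ∣ x →
    0 < half-inverse x × half-inverse x ≤ h × x * half-inverse x ≈± 1
  half-inverse-spec {x} p∤x with p ∣? x
  ... | yes p∣x = contradiction p∣x p∤x
  ... | no p∤x = proj₂ (half-inverse-exists p∤x)

  ≢±1 : 2 ≤ x → x ≤ h → ¬ x ≈± 1
  ≢±1 2≤x x≤h x≈±1 =
    <⇒≢ 2≤x (sym (half-injective (<⇒≤ 2≤x) x≤h (≤-trans (<⇒≤ 2≤x) x≤h) x≈±1))

  half-inverse-involution : (∀ {i} → 2 ≤ i → i ≤ h → ¬ p ∣ i * i + 1) →
    FreeInvolution (suc h) (2 ≤_) half-inverse
  half-inverse-involution no-root {x} x<1+h 2≤x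
    with half-inverse-spec (∤-between (<⇒≤ 2≤x) (≤h⇒<p (s≤s⁻¹ x<1+h)))
  ... | 0<z , z≤h , xz≈±1 = s≤s z≤h , 2≤z , zz≡x , z≢x
    where
    x≤h : x ≤ h
    x≤h = s≤s⁻¹ x<1+h
    z : ℕ
    z = half-inverse x
    2≤z : 2 ≤ z
    2≤z = ≤∧≢⇒< 0<z λ 1≡z →
      ≢±1 2≤x x≤h (subst (_≈± 1) (trans (cong (x *_) (sym 1≡z)) (*-identityʳ x)) xz≈±1)
    p∤z : ¬ p ∣ z
    p∤z = ∤-between 0<z (≤h⇒<p z≤h)
    zz≡x : half-inverse z ≡ x
    zz≡x with half-inverse-spec p∤z
    ... | 0<zz , zz≤h , zzz≈±1 =
      half-inverse-unique p∤z 0<zz zz≤h x≤h zzz≈±1 (subst (_≈± 1) (*-comm x z) xz≈±1)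
    z≢x : z ≢ x
    z≢x z≡x with subst (λ w → x * w ≈± 1) z≡x xz≈±1
    ... | same x²≈1 = ≢±1 2≤x x≤h (square≈1⇒≈±1 x²≈1)
    ... | opposite p∣x²+1 = no-root 2≤x x≤h p∣x²+1

  sqrt-minus-one : ∀ {m} → 0 < m → h ≡ 2 * m → ∃ λ i → 2 ≤ i × i ≤ h × p ∣ i * i + 1
  sqrt-minus-one {suc m} _ h≡2[1+m]
    with anyUpTo? (λ i → (2 ≤? i) ×-dec (p ∣? i * i + 1)) (suc h)
  ... | yes (i , i<1+h , 2≤i , p∣i²+1) = i , 2≤i , s≤s⁻¹ i<1+h , p∣i²+1
  ... | no ∄root with count-even (2 ≤?_) (half-inverse-involution no-root)
    where
    no-root : ∀ {i} → 2 ≤ i → i ≤ h → ¬ p ∣ i * i + 1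
    no-root 2≤i i≤h p∣i²+1 = ∄root (_ , s≤s i≤h , 2≤i , p∣i²+1)
  ...   | k , even = contradiction (trans (sym even) odd) (even≢odd k m)
    where
    odd : count (2 ≤?_) (suc h) ≡ suc (2 * m)
    odd = trans (count-atLeast 2 (suc h)) (trans (cong (_∸ 1) h≡2[1+m]) (+-suc m (m + 0)))

module IntervalDecomposition {p : ℕ} (pr : Prime p) {i L : ℕ}
  (p∣i²+1 : p ∣ i * i + 1) (2≤i : 2 ≤ i) (i<p : i < p) (i≤L : i ≤ L)
  (p≤2L+1 : p ≤ suc (L + L)) (p≢5 : p ≢ 5) where

  open PrimeModulus pr

  i*[p∸y]≈x : y ≤ p → y ≈ i * x → i * (p ∸ y) ≈ x
  i*[p∸y]≈x {y} {x} y≤p y≈ix = negation-unique p∣i[p∸y]+iy p∣x+iy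
    where
    p∣i[p∸y]+iy : p ∣ i * (p ∸ y) + i * y
    p∣i[p∸y]+iy = subst (p ∣_) (trans (cong (i *_) (sym (m∸n+n≡m y≤p))) (*-distribˡ-+ i (p ∸ y) y))
                        (n∣m*n i)
    expand : ∀ i x → (i * i + 1) * x ≡ x + i * (i * x)
    expand = solve-∀
    p∣x+iy : p ∣ x + i * y
    p∣x+iy = ∣-resp-≈ (+-congˡ x (*-congˡ i (sym y≈ix)))
                      (subst (p ∣_) (expand i x) (∣m⇒∣m*n x p∣i²+1))

  p∸y≤L : L < y → p ∸ y ≤ L
  p∸y≤L {y} L<y = begin
    p ∸ y                 ≤⟨ ∸-monoʳ-≤ p L<y ⟩
    p ∸ suc L             ≤⟨ ∸-monoˡ-≤ (suc L) p≤2L+1 ⟩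
    suc (L + L) ∸ suc L   ≡⟨ m+n∸n≡m L L ⟩
    L                     ∎
    where open ≤-Reasoning

  I? : Decidable (Interval p L)
  I? x = (1 ≤? toℕ x) ×-dec (toℕ x ≤? L)

  residue∈I : 0 < a → a ≤ L → a < p → Interval p L (residue a)
  residue∈I 0<a a≤L a<p = subst (λ w → 1 ≤ w × w ≤ L) (sym (toℕ-residue-< a<p)) (0<a , a≤L)

  1<p : 1 < p
  1<p = ≤-trans 2≤i (<⇒≤ i<p)

  2<p : 2 < p
  2<p = ≤-<-trans 2≤i i<p

  one ι two : Fin p
  one = residue 1
  ι   = residue i
  two = residue 2

  A : Subset p
  A = ⁅ one ⁆ ∪ ⁅ ι ⁆

  B? : Decidable (λ b → Interval p L b × Interval p L (mulMod ι b))
  B? b = I? b ×-dec I? (mulMod ι b)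

  B : Subset p
  B = subsetOf B?

  one∈A : one ∈ A
  one∈A = p⊆p∪q ⁅ ι ⁆ (x∈⁅x⁆ one)

  ι∈A : ι ∈ A
  ι∈A = q⊆p∪q ⁅ one ⁆ ⁅ ι ⁆ (x∈⁅x⁆ ι)

  ∈A⁻ : ∀ {a} → a ∈ A → a ≡ one ⊎ a ≡ ι
  ∈A⁻ a∈A = Sum.map (x∈⁅y⁆⇒x≡y one) (x∈⁅y⁆⇒x≡y ι) (x∈p∪q⁻ ⁅ one ⁆ ⁅ ι ⁆ a∈A)

  ι∈I : Interval p L ι
  ι∈I = residue∈I (<⇒≤ 2≤i) i≤L i<p

  one∈B : one ∈ B
  one∈B = ∈-subsetOf⁺ B?
    (residue∈I ≤-refl (≤-trans (<⇒≤ 2≤i) i≤L) 1<p , subst (Interval p L) (sym (mulMod-identityʳ ι)) ι∈I)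

  product⊆interval : ∀ {a b} → a ∈ A → b ∈ B → Interval p L (mulMod a b)
  product⊆interval {a} {b} a∈A b∈B with ∈A⁻ a∈A | ∈-subsetOf⁻ B? b∈B
  ... | inj₁ refl | b∈I , _ = subst (Interval p L) (sym (mulMod-identityˡ b)) b∈I
  ... | inj₂ refl | _ , ιb∈I = ιb∈I

  interval⊆product : ∀ {x} → Interval p L x → x ∈Prod[ A , B ]
  interval⊆product {x} x∈I with I? (mulMod ι x)
  ... | yes ιx∈I = one , x , one∈A , ∈-subsetOf⁺ B? (x∈I , ιx∈I) , mulMod-identityˡ x
  ... | no ιx∉I =
    ι , b̂ , ι∈A , ∈-subsetOf⁺ B? (b̂∈I , subst (Interval p L) (sym ιb̂≡x) x∈I) , ιb̂≡x
    where
    toℕ-ι : toℕ ι ≡ i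
    toℕ-ι = toℕ-residue-< i<p
    r : ℕ
    r = toℕ (mulMod ι x)
    r≈ix : r ≈ i * toℕ x
    r≈ix = trans (toℕ-residue (toℕ ι * toℕ x)) (cong (λ w → (w * toℕ x) % p) toℕ-ι)
    r≢0 : r ≢ 0
    r≢0 r≡0 = ∤-* (∤-between (<⇒≤ 2≤i) i<p) (∤-between (proj₁ x∈I) (toℕ<n x))
                (∣-resp-≈ (trans (cong (_% p) (sym r≡0)) r≈ix) (p ∣0))
    L<r : L < r
    L<r = ≰⇒> λ r≤L → ιx∉I (n≢0⇒n>0 r≢0 , r≤L)
    p∸r<p : p ∸ r < p
    p∸r<p = ∸-monoʳ-< (n≢0⇒n>0 r≢0) (<⇒≤ (toℕ<n (mulMod ι x)))
    b̂ : Fin p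
    b̂ = residue (p ∸ r)
    b̂∈I : Interval p L b̂
    b̂∈I = residue∈I (m<n⇒0<n∸m (toℕ<n (mulMod ι x))) (p∸y≤L L<r) p∸r<p
    ιb̂≡x : mulMod ι b̂ ≡ x
    ιb̂≡x = mulMod-≈ {ι} {b̂} (trans (cong (_% p) (cong₂ _*_ toℕ-ι (toℕ-residue-< p∸r<p)))
                                 (i*[p∸y]≈x (<⇒≤ (toℕ<n (mulMod ι x))) r≈ix))

  second∈B : ∃ λ b → b ∈ B × b ≢ one
  second∈B with interval⊆product (residue∈I (s≤s z≤n) (≤-trans 2≤i i≤L) 2<p)
  ... | a , b , a∈A , b∈B , ab≡two = b , b∈B , b≢one
    where
    b≢one : b ≢ one
    b≢one refl with ∈A⁻ a∈A
    ... | inj₁ refl =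
      contradiction (residue-injective 1<p 2<p (trans (sym (mulMod-identityʳ one)) ab≡two)) λ ()
    ... | inj₂ refl =
      p≢5 (∣-prime⇒≡ (from-yes (prime? 5)) (subst (λ j → p ∣ j * j + 1) i≡2 p∣i²+1))
      where
      i≡2 : i ≡ 2
      i≡2 = residue-injective i<p 2<p (trans (sym (mulMod-identityʳ ι)) ab≡two)

  decomposition : HasNontrivialMultDecomp p (Interval p L)
  decomposition with second∈B
  ... | b , b∈B , b≢one =
    A , B ,
    (one , ι , one∈A , ι∈A , λ one≡ι → <⇒≢ 2≤i (residue-injective 1<p i<p one≡ι)) ,
    (one , b , one∈B , b∈B , ≢-sym b≢one) ,
    λ x → mk⇔ (interval⊆product ∘ proj₁) nonzero-interval
    where
    nonzero-interval : ∀ {x} → x ∈Prod[ A , B ] → Interval p L x × toℕ x ≢ 0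
    nonzero-interval {x} (a , b , a∈A , b∈B , ab≡x) = x∈I , λ x≡0 → <⇒≢ (proj₁ x∈I) (sym x≡0)
      where
      x∈I : Interval p L x
      x∈I = subst (Interval p L) ab≡x (product⊆interval a∈A b∈B)

≡1-mod-4 : ∀ p → p % 4 ≡ 1 → p ≡ suc (2 * (p / 4) + 2 * (p / 4))
≡1-mod-4 p p%4≡1 =
  trans (m≡m%n+[m/n]*n p 4) (trans (cong (_+ p / 4 * 4) p%4≡1) (regroup (p / 4)))
  where
  regroup : ∀ m → 1 + m * 4 ≡ suc (2 * m + 2 * m)
  regroup = solve-∀

theorem2 : (p : ℕ) → (pr : Prime p) → p % 4 ≡ 1 → p ≢ 5 →
    (L : ℕ) → (p ∸ 1) / 2 ≤ L → L ≤ p ∸ 1 →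
    HasNontrivialMultDecomp p {{prime⇒nonZero pr}} (Interval p L)
theorem2 p pr p%4≡1 p≢5 L [p∸1]/2≤L _ = decompose (sqrt-minus-one 0<m refl)
  where
  m h : ℕ
  m = p / 4
  h = 2 * m
  p≡2h+1 : p ≡ suc (h + h)
  p≡2h+1 = ≡1-mod-4 p p%4≡1
  open HalfSystem pr {h} p≡2h+1
  0<m : 0 < m
  0<m = n≢0⇒n>0 λ m≡0 →
    ¬prime[1] (subst Prime (trans p≡2h+1 (cong (λ m → suc (2 * m + 2 * m)) m≡0)) pr)
  h≤L : h ≤ L
  h≤L = subst (_≤ L) [p∸1]/2≡h [p∸1]/2≤L
    where
    double : ∀ h → h + h ≡ h * 2
    double = solve-∀
    [p∸1]/2≡h : (p ∸ 1) / 2 ≡ h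
    [p∸1]/2≡h = trans (cong (λ q → (q ∸ 1) / 2) p≡2h+1) (trans (cong (_/ 2) (double h)) (m*n/n≡m h 2))
  decompose : (∃ λ i → 2 ≤ i × i ≤ h × p ∣ i * i + 1) →
    HasNontrivialMultDecomp p {{prime⇒nonZero pr}} (Interval p L)
  decompose (i , 2≤i , i≤h , p∣i²+1) =
    IntervalDecomposition.decomposition pr p∣i²+1 2≤i (≤h⇒<p i≤h) (≤-trans i≤h h≤L) p≤2L+1 p≢5
    where
    p≤2L+1 : p ≤ suc (L + L)
    p≤2L+1 = subst (_≤ suc (L + L)) (sym p≡2h+1) (s≤s (+-mono-≤ h≤L h≤L))
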